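{- Let $a,b$ be positive integers with $a$ even, and $k=ab$. For $1\le i\le b$ let $L_i$ be the sequence of even integers in $[1+(i-1)a,\ ia]$ in decreasing order, and $R_i$ the sequence of odd integers in $[1+ia,\ (i+1)a]$ in increasing order, and let $T_i$ be the sequence obtained by interleaving $L_i$ and $R_i$ (alternating, starting with the first element of $L_i$). Let $\pi(a,b)$ be the unique permutation of $[k]$ with the same relative ordering as the concatenation $T_1T_2\cdots T_b$. Then $\pi(a,b)$ avoids the pattern $(4,3,1,2)$.
   Context: A permutation $\pi$ of $[k]$ contains $\sigma$ of $[m]$ if there are indices $i_1<\dots<i_m$ with $\pi(i_j)<\pi(i_\ell)\iff\sigma(j)<\sigma(\ell)$ for all $j,\ell$; otherwise $\pi$ avoids $\sigma$. Two sequences of distinct numbers of equal length have the same relative ordering if their $j$-th and $\ell$-th entries compare the same way for all $j,\ell$. -}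

module Defs where

open import Data.Nat using (ℕ; zero; suc; _+_; _*_; _∸_; _<_; _%_; _<?_)
open import Data.Nat.Properties using (_≟_)
open import Data.List using (List; []; _∷_; filter; reverse; map; length; lookup; applyUpTo; concatMap)
open import Data.Fin as Fin using (Fin)
open import Data.Product using (Σ; _×_)
open import Function.Bundles using (_⇔_)

interval : ℕ → ℕ → List ℕ
interval lo hi = applyUpTo (λ j → lo + j) (suc hi ∸ lo)

evens odds : List ℕ → List ℕ
evens = filter (λ n → n % 2 ≟ 0)
odds  = filter (λ n → n % 2 ≟ 1)

L : ℕ → ℕ → List ℕ
L a i = reverse (evens (interval (1 + (i ∸ 1) * a) (i * a)))

R : ℕ → ℕ → List ℕ
R a i = odds (interval (1 + i * a) ((i + 1) * a))

interleave : List ℕ → List ℕ → List ℕ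
interleave []       ys = ys
interleave (x ∷ xs) ys = x ∷ interleave′ xs ys
  where
  interleave′ : List ℕ → List ℕ → List ℕ
  interleave′ xs []       = xs
  interleave′ xs (y ∷ ys) = y ∷ interleave xs ys

T : ℕ → ℕ → List ℕ
T a i = interleave (L a i) (R a i)

word : ℕ → ℕ → List ℕ
word a b = concatMap (T a) (applyUpTo suc b)

-- standardization: the permutation of [k] (one-line notation, values 1..k)
-- with the same relative ordering as a list of distinct numbers:
-- each entry is replaced by 1 + (number of entries smaller than it).
std : List ℕ → List ℕ
std s = map (λ x → suc (length (filter (_<? x) s))) s

πab : ℕ → ℕ → List ℕ
πab a b = std (word a b)

Contains : List ℕ → List ℕ → Set
Contains π σ =
  Σ (Fin (length σ) → Fin (length π)) λ f →
    (∀ j l → j Fin.< l → f j Fin.< f l) ×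
    (∀ j l → (lookup π (f j) < lookup π (f l)) ⇔ (lookup σ j < lookup σ l))

-- Read the word T₁T₂⋯T_b from left to right. Its odd entries increase, and
-- every later entry smaller than an even entry x is an even entry of x's own
-- run L_i, where entries decrease. So among the entries after an even x, any
-- two below x form a descent; an occurrence of 4312 (whose 1 and 2 form an
-- ascent below the 4 and the 3) therefore needs both the 4 and the 3 odd, which
-- contradicts the increase of odd entries. Standardisation preserves relative
-- order.
module Submission where

open import Defs
open import Data.Nat using (ℕ; _≤_; _*_)
open import Data.Nat.Divisibility using (_∣_)
open import Data.List using (List; []; _∷_)
open import Relation.Nullary using (¬_)

open import Data.Nat using (suc; _+_; _∸_; _<_; _%_; _<?_; s≤s; s≤s⁻¹; z<s; s<s)
open import Data.Nat.Properties
  using (_≟_; +-comm; +-monoʳ-<; *-monoˡ-≤; *-cancelʳ-<; m≤m+n; m≤n+m; m+[n∸m]≡n; m∸n≢0⇒n<m; n≮0; n<1+n;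
         ≤-reflexive; ≤-trans; ≤-antisym; <-trans; <-≤-trans; ≤-<-trans; <-asym; <⇒≤; <⇒≱; ≮⇒≥)
open import Data.Nat.DivMod using (m%n<n)
open import Data.List using (length; lookup; filter; reverse; map)
open import Data.List.Properties using (length-map; unfold-reverse)
open import Data.List.Membership.Propositional.Properties using (∈-lookup)
open import Data.List.Relation.Unary.Any.Properties using (reverse⁻)
open import Data.List.Relation.Unary.All as All using (All; []; _∷_)
import Data.List.Relation.Unary.All.Properties as All
open import Data.List.Relation.Unary.AllPairs as AllPairs using (AllPairs; []; _∷_)
import Data.List.Relation.Unary.AllPairs.Properties as AllPairs
open import Data.List.Relation.Binary.Sublist.Propositional using (⊆-refl)
open import Data.List.Relation.Binary.Sublist.Propositional.Properties as Sublist using (length-mono-≤)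
open import Data.Fin as Fin using (Fin; #_)
open import Data.Fin.Properties using (toℕ-cast)
open import Data.Product using (_×_; _,_; proj₁; proj₂)
open import Data.Sum using (_⊎_; inj₁; inj₂)
open import Data.Empty using (⊥; ⊥-elim)
open import Function using (flip; _∘_)
open import Function.Bundles using (Equivalence)
open import Relation.Nullary using (Dec; yes; no)
open import Relation.Binary.PropositionalEquality using (_≡_; refl; sym; trans; cong; subst; subst₂)

module _ {A : Set} where

  All-reverse⁺ : ∀ {P : A → Set} {xs} → All P xs → All P (reverse xs)
  All-reverse⁺ pxs = All.tabulate (λ x∈ → All.lookup pxs (reverse⁻ x∈))

  AllPairs-reverse⁺ : ∀ {R : A → A → Set} {xs} → AllPairs R xs → AllPairs (flip R) (reverse xs)
  AllPairs-reverse⁺ [] = []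
  AllPairs-reverse⁺ {xs = x ∷ xs} (rx ∷ rxs) rewrite unfold-reverse x xs =
    AllPairs.++⁺ (AllPairs-reverse⁺ rxs) ([] ∷ []) (All.map (_∷ []) (All-reverse⁺ rx))

  AllPairs-map-All : ∀ {P : A → Set} {R S : A → A → Set} {xs} →
                     (∀ {x y} → P x → P y → R x y → S x y) → All P xs → AllPairs R xs → AllPairs S xs
  AllPairs-map-All f [] [] = []
  AllPairs-map-All f (px ∷ pxs) (rx ∷ rxs) =
    All.zipWith (λ (py , r) → f px py r) (pxs , rx) ∷ AllPairs-map-All f pxs rxs

  allPairs-lookup : ∀ {R : A → A → Set} {xs} → AllPairs R xs →
                    ∀ {i j} → i Fin.< j → R (lookup xs i) (lookup xs j)
  allPairs-lookup (rx ∷ rxs) {Fin.zero} {Fin.suc j} _ = All.lookup rx (∈-lookup j)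
  allPairs-lookup (rx ∷ rxs) {Fin.suc i} {Fin.suc j} i<j = allPairs-lookup rxs (s≤s⁻¹ i<j)

lookup-map : ∀ {A B : Set} (h : A → B) xs (i : Fin (length (map h xs))) →
             lookup (map h xs) i ≡ h (lookup xs (Fin.cast (length-map h xs) i))
lookup-map h (x ∷ xs) Fin.zero = refl
lookup-map h (x ∷ xs) (Fin.suc i) = lookup-map h xs i

count< : List ℕ → ℕ → ℕ
count< s x = length (filter (_<? x) s)

count<-mono : ∀ s {x y} → x ≤ y → count< s x ≤ count< s y
count<-mono s x≤y =
  length-mono-≤ (Sublist.filter⁺ (_<? _) (_<? _) (λ { refl z<x → <-≤-trans z<x x≤y }) (⊆-refl {x = s}))

std-reflects-< : ∀ s (i j : Fin (length (std s))) → lookup (std s) i < lookup (std s) j →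
                 lookup s (Fin.cast (length-map _ s) i) < lookup s (Fin.cast (length-map _ s) j)
std-reflects-< s i j lt
  rewrite lookup-map (λ x → suc (count< s x)) s i | lookup-map (λ x → suc (count< s x)) s j
  with lookup s (Fin.cast (length-map _ s) i) <? lookup s (Fin.cast (length-map _ s) j)
... | yes x<y = x<y
... | no x≮y = ⊥-elim (<⇒≱ (s≤s⁻¹ lt) (count<-mono s (≮⇒≥ x≮y)))

All-interleave⁺ : ∀ {P : ℕ → Set} {xs ys} → All P xs → All P ys → All P (interleave xs ys)
All-interleave⁺ [] pys = pys
All-interleave⁺ (px ∷ pxs) [] = px ∷ pxs
All-interleave⁺ (px ∷ pxs) (py ∷ pys) = px ∷ py ∷ All-interleave⁺ pxs pys

AllPairs-interleave⁺ : ∀ {R : ℕ → ℕ → Set} {xs ys} → AllPairs R xs → AllPairs R ys →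
                       All (λ x → All (λ y → R x y × R y x) ys) xs → AllPairs R (interleave xs ys)
AllPairs-interleave⁺ [] rys _ = rys
AllPairs-interleave⁺ {xs = _ ∷ _} {[]} rxs [] _ = rxs
AllPairs-interleave⁺ {ys = _ ∷ _} (rx ∷ rxs) (ry ∷ rys) (rxys ∷ rxsys) =
  (proj₁ (All.head rxys) ∷ All-interleave⁺ rx (All.map proj₁ (All.tail rxys))) ∷
  (All-interleave⁺ (All.map (proj₂ ∘ All.head) rxsys) ry ∷
   AllPairs-interleave⁺ rxs rys (All.map All.tail rxsys))

interval-bounds : ∀ lo hi → All (λ v → lo ≤ v × v ≤ hi) (interval lo hi)
interval-bounds lo hi = All.applyUpTo⁺₁ _ (suc hi ∸ lo) (λ {i} i<n → m≤m+n lo i , s≤s⁻¹ (lo+i<1+hi i<n))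
  where
  lo+i<1+hi : ∀ {i} → i < suc hi ∸ lo → lo + i < suc hi
  lo+i<1+hi {i} i<n = subst (lo + i <_) (m+[n∸m]≡n lo≤1+hi) (+-monoʳ-< lo i<n)
    where
    lo≤1+hi : lo ≤ suc hi
    lo≤1+hi = <⇒≤ (m∸n≢0⇒n<m (λ eq → n≮0 (subst (i <_) eq i<n)))

interval-increasing : ∀ lo hi → AllPairs _<_ (interval lo hi)
interval-increasing lo hi = AllPairs.applyUpTo⁺₁ _ (suc hi ∸ lo) (λ i<j _ → +-monoʳ-< lo i<j)

Even Odd : ℕ → Set
Even v = v % 2 ≡ 0
Odd  v = v % 2 ≡ 1

even-or-odd : ∀ v → Even v ⊎ Odd v
even-or-odd v with v % 2 | m%n<n v 2
... | 0 | _ = inj₁ refl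
... | 1 | _ = inj₂ refl
... | suc (suc _) | s≤s (s≤s ())

even⇒¬odd : ∀ {v} → Even v → ¬ Odd v
even⇒¬odd e o with trans (sym e) o
... | ()

-- Block m, counted from 0, is T_{m+1}: EvenIn a m describes the entries of
-- L_{m+1}, OddIn a m those of R_{m+1}.
record EvenIn (a m v : ℕ) : Set where
  constructor evenIn
  field
    even  : Even v
    lower : m * a < v
    upper : v ≤ suc m * a

record OddIn (a m v : ℕ) : Set where
  constructor oddIn
  field
    odd   : Odd v
    lower : suc m * a < v
    upper : v ≤ suc (suc m) * a

evenIn⇒¬odd : ∀ {a m v} → EvenIn a m v → ¬ Odd v
evenIn⇒¬odd {v = v} vm = even⇒¬odd {v} (EvenIn.even vm)

InBlock : ℕ → ℕ → ℕ → Set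
InBlock a m v = EvenIn a m v ⊎ OddIn a m v

record SameEvenBlock (a x y : ℕ) : Set where
  constructor sameEvenBlock
  field
    {block} : ℕ
    left    : EvenIn a block x
    right   : EvenIn a block y

evenIn-unique : ∀ {a m n v} → EvenIn a m v → EvenIn a n v → m ≡ n
evenIn-unique {a} {m} {n} {v} (evenIn _ ma<v v≤[1+m]a) (evenIn _ na<v v≤[1+n]a) =
  ≤-antisym (below ma<v v≤[1+n]a) (below na<v v≤[1+m]a)
  where
  below : ∀ {k l} → k * a < v → v ≤ suc l * a → k ≤ l
  below {k} {l} ka<v v≤[1+l]a = s≤s⁻¹ (*-cancelʳ-< a k (suc l) (<-≤-trans ka<v v≤[1+l]a))

sameEvenBlock⇒evenIn : ∀ {a m x y} → EvenIn a m x → SameEvenBlock a x y → EvenIn a m y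
sameEvenBlock⇒evenIn xm (sameEvenBlock xk yk) with refl ← evenIn-unique xm xk = yk

sameEvenBlock-euclidean : ∀ {a x y z} → SameEvenBlock a x y → SameEvenBlock a x z → SameEvenBlock a y z
sameEvenBlock-euclidean (sameEvenBlock xk yk) x~z = sameEvenBlock yk (sameEvenBlock⇒evenIn xk x~z)

inBlock-lower : ∀ {a m v} → InBlock a m v → m * a < v
inBlock-lower (inj₁ vm) = EvenIn.lower vm
inBlock-lower {a} {m} (inj₂ vm) = ≤-<-trans (m≤n+m (m * a) a) (OddIn.lower vm)

-- The relation between an entry x of the word and every entry y after it.
record Compatible (a x y : ℕ) : Set where
  field
    odds-ascend              : Odd x → Odd y → x < y
    below-even-same-block    : Even x → y < x → SameEvenBlock a x y
    same-even-block-descends : SameEvenBlock a x y → y < x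

odd-compatible : ∀ {a x y} → Odd x → (Odd y → x < y) → Compatible a x y
odd-compatible {x = x} ox x<y = record
  { odds-ascend              = λ _ oy → x<y oy
  ; below-even-same-block    = λ ex _ → ⊥-elim (even⇒¬odd {x} ex ox)
  ; same-even-block-descends = λ x~y → ⊥-elim (evenIn⇒¬odd (SameEvenBlock.left x~y) ox)
  }

evenIn-compatible-descending : ∀ {a m x y} → EvenIn a m x → EvenIn a m y → y < x → Compatible a x y
evenIn-compatible-descending xm ym y<x = record
  { odds-ascend              = λ ox _ → ⊥-elim (evenIn⇒¬odd xm ox)
  ; below-even-same-block    = λ _ _ → sameEvenBlock xm ym
  ; same-even-block-descends = λ _ → y<x
  }

evenIn-compatible-above : ∀ {a m x y} → EvenIn a m x → suc m * a < y → Compatible a x y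
evenIn-compatible-above {a} {m} {x} {y} xm [1+m]a<y = record
  { odds-ascend              = λ ox _ → ⊥-elim (evenIn⇒¬odd xm ox)
  ; below-even-same-block    = λ _ y<x → ⊥-elim (<-asym y<x x<y)
  ; same-even-block-descends = λ x~y →
      ⊥-elim (<⇒≱ [1+m]a<y (EvenIn.upper (sameEvenBlock⇒evenIn xm x~y)))
  }
  where
  x<y : x < y
  x<y = ≤-<-trans (EvenIn.upper xm) [1+m]a<y

inBlock-compatible : ∀ {a m n x y} → m < n → InBlock a m x → InBlock a n y → Compatible a x y
inBlock-compatible {a} m<n (inj₁ xm) y∈n =
  evenIn-compatible-above xm (≤-<-trans (*-monoˡ-≤ a m<n) (inBlock-lower y∈n))
inBlock-compatible {a} {n = n} {x} m<n (inj₂ xm) y∈n = odd-compatible (OddIn.odd xm) (x<odd y∈n)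
  where
  x<odd : ∀ {y} → InBlock a n y → Odd y → x < y
  x<odd (inj₁ yn) oy = ⊥-elim (evenIn⇒¬odd yn oy)
  x<odd (inj₂ yn) _  = ≤-<-trans (≤-trans (OddIn.upper xm) (*-monoˡ-≤ a (s≤s m<n))) (OddIn.lower yn)

module _ (a m : ℕ) where

  even? : ∀ v → Dec (Even v)
  even? v = v % 2 ≟ 0

  odd? : ∀ v → Dec (Odd v)
  odd? v = v % 2 ≟ 1

  L-evenIn : All (EvenIn a m) (L a (suc m))
  L-evenIn = All-reverse⁺ (All.zipWith (λ (e , lo , hi) → evenIn e lo hi)
    ( All.all-filter even? (interval (suc (m * a)) (suc m * a))
    , All.filter⁺ even? (interval-bounds (suc (m * a)) (suc m * a))))

  R-oddIn : All (OddIn a m) (R a (suc m))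
  R-oddIn = All.zipWith (λ (o , lo , hi) → oddIn o lo (≤-trans hi (≤-reflexive (cong (_* a) (+-comm (suc m) 1)))))
    ( All.all-filter odd? (interval (suc (suc m * a)) ((suc m + 1) * a))
    , All.filter⁺ odd? (interval-bounds (suc (suc m * a)) ((suc m + 1) * a)))

  L-descending : AllPairs (flip _<_) (L a (suc m))
  L-descending = AllPairs-reverse⁺ (AllPairs.filter⁺ even? (interval-increasing (suc (m * a)) (suc m * a)))

  R-ascending : AllPairs _<_ (R a (suc m))
  R-ascending = AllPairs.filter⁺ odd? (interval-increasing (suc (suc m * a)) ((suc m + 1) * a))

  T-inBlock : All (InBlock a m) (T a (suc m))
  T-inBlock = All-interleave⁺ (All.map inj₁ L-evenIn) (All.map inj₂ R-oddIn)

  T-compatible : AllPairs (Compatible a) (T a (suc m))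
  T-compatible = AllPairs-interleave⁺
    (AllPairs-map-All evenIn-compatible-descending L-evenIn L-descending)
    (AllPairs-map-All (λ xm _ x<y → odd-compatible (OddIn.odd xm) (λ _ → x<y)) R-oddIn R-ascending)
    (All.map (λ xm → All.map (λ yn →
        evenIn-compatible-above xm (OddIn.lower yn) ,
        odd-compatible (OddIn.odd yn) (λ ox → ⊥-elim (evenIn⇒¬odd xm ox)))
      R-oddIn) L-evenIn)

word-compatible : ∀ a b → AllPairs (Compatible a) (word a b)
word-compatible a b = AllPairs.concat⁺
  (All.map⁺ (All.applyUpTo⁺₂ suc b (T-compatible a)))
  (AllPairs.map⁺ (AllPairs.applyUpTo⁺₁ suc b (λ {m} {n} m<n _ →
    All.map (λ x∈m → All.map (inBlock-compatible m<n x∈m) (T-inBlock a n)) (T-inBlock a m))))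

no-ascent-below-even : ∀ {a x r s} → Even x → Compatible a x r → Compatible a x s → Compatible a r s →
                       r < s → s < x → ⊥
no-ascent-below-even ex x→r x→s r→s r<s s<x =
  <-asym r<s (Compatible.same-even-block-descends r→s (sameEvenBlock-euclidean
    (Compatible.below-even-same-block x→r ex (<-trans r<s s<x))
    (Compatible.below-even-same-block x→s ex s<x)))

compatible-avoids-4312 : ∀ {a} (v : Fin 4 → ℕ) → (∀ {j l} → j Fin.< l → Compatible a (v j) (v l)) →
                         v (# 2) < v (# 3) → v (# 3) < v (# 1) → v (# 1) < v (# 0) → ⊥
compatible-avoids-4312 v compatible v₂<v₃ v₃<v₁ v₁<v₀ with even-or-odd (v (# 0)) | even-or-odd (v (# 1))
... | inj₁ e₀ | _ = no-ascent-below-even e₀ (compatible z<s) (compatible z<s) (compatible (s<s (s<s z<s)))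
                      v₂<v₃ (<-trans v₃<v₁ v₁<v₀)
... | inj₂ _ | inj₁ e₁ = no-ascent-below-even e₁ (compatible (s<s z<s)) (compatible (s<s z<s))
                      (compatible (s<s (s<s z<s))) v₂<v₃ v₃<v₁
... | inj₂ o₀ | inj₂ o₁ = <-asym v₁<v₀ (Compatible.odds-ascend (compatible z<s) o₀ o₁)

cast-mono-< : ∀ {m n} .(eq : m ≡ n) {i j : Fin m} → i Fin.< j → Fin.cast eq i Fin.< Fin.cast eq j
cast-mono-< eq {i} {j} = subst₂ _<_ (sym (toℕ-cast eq i)) (sym (toℕ-cast eq j))

mainTheorem5 : (a b : ℕ) → 1 ≤ a → 1 ≤ b → 2 ∣ a →
    ¬ Contains (πab a b) (4 ∷ 3 ∷ 1 ∷ 2 ∷ [])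
mainTheorem5 a b _ _ _ (f , increasing , order-isomorphic) =
  compatible-avoids-4312 v
    (λ {j} {l} j<l → allPairs-lookup (word-compatible a b) (cast-mono-< _ (increasing j l j<l)))
    (ascent (# 2) (# 3) (n<1+n _)) (ascent (# 3) (# 1) (n<1+n _)) (ascent (# 1) (# 0) (n<1+n _))
  where
  w : List ℕ
  w = word a b

  v : Fin 4 → ℕ
  v k = lookup w (Fin.cast (length-map _ w) (f k))

  ascent : ∀ j l → lookup (4 ∷ 3 ∷ 1 ∷ 2 ∷ []) j < lookup (4 ∷ 3 ∷ 1 ∷ 2 ∷ []) l → v j < v l
  ascent j l σj<σl = std-reflects-< w (f j) (f l) (Equivalence.from (order-isomorphic j l) σj<σl)
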